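{- For every critical table $T\in\mathcal{M}_k^2$ there exists a mapping $\nu:E_k^{W(T)}\to E_2$ such that $h^d(J(\nu,T))>\log_k(W(T)/2)$.
   Context: Fix an integer $k\ge 2$; $E_k=\{0,\ldots,k-1\}$, $E_2=\{0,1\}$, $P=\{f_i:i\in\{0,1,2,\ldots\}\}$ a set of attribute names. $\mathcal{M}_k^2$ is the set of rectangular tables filled with numbers from $E_k$, columns labeled with pairwise different attributes from $P$, rows pairwise different, each row labeled with a decision from $E_2$; the table without rows is denoted $\Lambda$. $P(T)$ is the set of column attributes; $W(T)$ is the number of columns. $T(f_{i_1},\delta_1)\cdots(f_{i_m},\delta_m)$ is the table of rows of $T$ having values $\delta_1,\ldots,\delta_m$ in the columns labeled $f_{i_1},\ldots,f_{i_m}$. A table $T$ is critical if $T\ne\Lambda$ and for every attribute of $T$ there are two rows of $T$ that differ only in the column labeled with this attribute. For $\nu:E_k^{W(T)}\to E_2$, $J(\nu,T)$ is obtained from $T$ by replacing the decision of each row $\bar\delta$ with $\nu(\bar\delta)$. A $k$-decision tree: finite directed rooted tree with at least two nodes, root and its leaving edges unlabeled, terminal nodes labeled with decisions from $E_2$, other nodes labeled with attributes from $P$ whose leaving edges are labeled with numbers from $E_k$; $P(\Gamma)$ is the set of attributes labeling nodes. For a complete path $\tau=v_1,d_1,\ldots,v_m,d_m,v_{m+1}$ (root to terminal node), $T(\tau)=T$ if $m=1$, else $T(f_{i_2},\delta_2)\cdots(f_{i_m},\delta_m)$ where $v_j$ is labeled $f_{i_j}$ and $d_j$ is labeled $\delta_j$.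 The depth $h(\Gamma)$ is the maximum of $m-1$ over complete paths. For $T\ne\Lambda$, a deterministic decision tree for $T$: exactly one edge leaves the root, edges leaving any other nonterminal node have pairwise different labels, $P(\Gamma)\subseteq P(T)$, every row of $T$ lies in some $T(\tau)$, and for every complete path either $T(\tau)=\Lambda$ or all rows of $T(\tau)$ have the terminal node's decision. $h^d(T)$ is the minimum depth of a deterministic decision tree for $T$. -}

module Defs where

open import Data.Nat using (ℕ; zero; suc; _≤_; _⊔_; NonZero)
open import Data.Fin using (Fin; zero; suc)
open import Data.Vec using (Vec; lookup)
open import Data.List using (List; []; _∷_; map)
open import Data.List.Membership.Propositional using (_∈_)
open import Data.List.Relation.Unary.All using (All)
open import Data.List.Relation.Unary.Unique.Propositional using (Unique)
open import Data.Product using (Σ; ∃; ∃-syntax; _×_; _,_; proj₁; proj₂)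
open import Data.Unit using (⊤)
open import Relation.Nullary using (¬_)
open import Relation.Binary.PropositionalEquality using (_≡_)

-- E_k = Fin k, E_2 = Fin 2.  Attribute f_i is represented by its index i : ℕ.

record Table (k : ℕ) : Set where
  field
    W        : ℕ
    attrs    : Vec ℕ W
    attrs-distinct : ∀ i j → lookup attrs i ≡ lookup attrs j → i ≡ j
    rows     : List (Vec (Fin k) W × Fin 2)
    rows-distinct : Unique (map proj₁ rows)
open Table public

J : ∀ {k} → (T : Table k) → (Vec (Fin k) (W T) → Fin 2) → Table k
J T ν = record
  { W = W T
  ; attrs = attrs T
  ; attrs-distinct = attrs-distinct T
  ; rows = map (λ r → proj₁ r , ν (proj₁ r)) (rows T)
  ; rows-distinct = uniq (rows T) (rows-distinct T)
  }
  where
  open import Data.List.Relation.Unary.AllPairs using (AllPairs; []; _∷_)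
  open import Data.List.Relation.Unary.All using ([]; _∷_)
  allmap : ∀ {x} (l : List (Vec (Fin _) (W T) × Fin 2)) →
           All (λ y → ¬ x ≡ y) (map proj₁ l) →
           All (λ y → ¬ x ≡ y) (map proj₁ (map (λ r → proj₁ r , ν (proj₁ r)) l))
  allmap [] [] = []
  allmap (_ ∷ l) (p ∷ ps) = p ∷ allmap l ps
  uniq : (l : List (Vec (Fin _) (W T) × Fin 2)) → Unique (map proj₁ l) →
         Unique (map proj₁ (map (λ r → proj₁ r , ν (proj₁ r)) l))
  uniq [] [] = []
  uniq (_ ∷ l) (p ∷ ps) = allmap l p ∷ uniq l ps

Critical : ∀ {k} → Table k → Set
Critical T =
  Σ _ (λ r → r ∈ rows T) ×
  (∀ (j : Fin (W T)) → ∃[ r₁ ] ∃[ r₂ ] (r₁ ∈ rows T × r₂ ∈ rows T ×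
      ¬ (lookup (proj₁ r₁) j ≡ lookup (proj₁ r₂) j) ×
      (∀ j′ → ¬ (j′ ≡ j) → lookup (proj₁ r₁) j′ ≡ lookup (proj₁ r₂) j′)))

-- The unique child of the root of a deterministic decision tree, i.e. the
-- node below the root.
data Node (k : ℕ) : Set where
  leaf  : Fin 2 → Node k
  query : (a : ℕ) (n : ℕ) → (Fin n → Fin k) → (Fin n → Node k) → Node k

maxF : (n : ℕ) → (Fin n → ℕ) → ℕ
maxF zero f = 0
maxF (suc n) f = f zero ⊔ maxF n (λ i → f (suc i))

depth : ∀ {k} → Node k → ℕ
depth (leaf _) = 0
depth (query a n lab ch) = suc (maxF n (λ i → depth (ch i)))

data Path {k : ℕ} : Node k → List (ℕ × Fin k) → Fin 2 → Set where
  leafP : ∀ {d} → Path (leaf d) [] d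
  stepP : ∀ {a n lab ch cs d} (i : Fin n) → Path (ch i) cs d →
          Path (query a n lab ch) ((a , lab i) ∷ cs) d

-- row value tuple v belongs to T(f_{i_1},δ_1)...(f_{i_m},δ_m)
Sat : ∀ {k} (T : Table k) → List (ℕ × Fin k) → Vec (Fin k) (W T) → Set
Sat T cs v = All (λ c → ∃[ j ] (lookup (attrs T) j ≡ proj₁ c × lookup v j ≡ proj₂ c)) cs

WellFormed : ∀ {k} (T : Table k) → Node k → Set
WellFormed T (leaf _) = ⊤
WellFormed T (query a n lab ch) =
  NonZero n × (∀ i j → lab i ≡ lab j → i ≡ j) ×
  (∃[ j ] lookup (attrs T) j ≡ a) × (∀ i → WellFormed T (ch i))

IsDetTree : ∀ {k} (T : Table k) → Node k → Set
IsDetTree T t =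
  WellFormed T t ×
  (∀ r → r ∈ rows T → ∃[ cs ] ∃[ d ] (Path t cs d × Sat T cs (proj₁ r))) ×
  (∀ cs d → Path t cs d → ∀ r → r ∈ rows T → Sat T cs (proj₁ r) → proj₂ r ≡ d)

IsHd : ∀ {k} → Table k → ℕ → Set
IsHd T d = (∃[ t ] (IsDetTree T t × depth t ≡ d)) ×
           (∀ t → IsDetTree T t → d ≤ depth t)

{-# OPTIONS --safe #-}
-- For every column j fix a pair of rows of T that differ only in column j, let a j be the
-- value of the first of them in column j, and let ν δ be the parity of the number of
-- columns j with δ j = a j.  The two rows of the j-th pair then get different decisions
-- in J(ν,T), and as they agree outside column j, every deterministic decision tree for
-- J(ν,T) must query f_j on the way to one of them.  So such a tree queries all W(T)
-- attributes, while a tree of depth h has at most 1 + k + … + k^(h-1) < k^h attribute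
-- nodes; hence W(T) < k^h.  The minimum depth h^d exists at all because solvability by a
-- tree of depth at most d has a decidable characterisation by recursive splitting.

module Submission where

open import Defs
open import Data.Nat using (ℕ; _≤_; _<_; _*_; _^_)
open import Data.Fin using (Fin)
open import Data.Vec using (Vec)
open import Data.Product using (∃-syntax; _×_)

open import Data.Nat as ℕ using (zero; suc; _+_; z≤n; s≤s; NonZero)
open import Data.Nat.Properties
  using (≤-refl; ≤-trans; ≤-antisym; m≤m⊔n; m≤n⊔m; ⊔-lub; ≮⇒≥; m<1+n⇒m<n∨m≡n;
         +-mono-≤; +-monoˡ-≤; *-monoˡ-≤; *-monoʳ-≤; *-suc; m≤n*m; <⇒≤pred; module ≤-Reasoning)
open import Data.Fin using (zero; suc; _≟_)
open import Data.Fin.Properties using (any?; all?; ¬∀⟶∃¬; injective⇒≤; suc-injective)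
open import Data.Vec using (lookup; tabulate)
open import Data.Vec.Properties using (tabulate∘lookup; tabulate-cong)
open import Data.List using (List; []; _∷_; map; filter; length; concat)
import Data.List as List
open import Data.List.Properties using (filter-notAll; length-++)
open import Data.List.Membership.Propositional using (_∈_)
open import Data.List.Membership.Propositional.Properties
  using (∈-filter⁺; ∈-filter⁻; ∈-map⁺; ∈-concat⁺′; ∈-tabulate⁺)
open import Data.List.Relation.Unary.All as All using (All; []; _∷_)
open import Data.List.Relation.Unary.Any as Any using (here; there)
open import Data.List.Relation.Unary.Any.Properties using (lookup-index)
open import Data.List.Relation.Unary.AllPairs using (_∷_)
import Data.List.Relation.Unary.AllPairs.Properties as AllPairs
open import Data.List.Relation.Unary.Unique.Propositional using (Unique)
open import Data.Product using (_,_; proj₁; proj₂)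
open import Data.Sum using (_⊎_; inj₁; inj₂)
open import Data.Unit using (tt)
open import Data.Bool using (Bool; true; false; not; _xor_)
open import Data.Bool.Properties using (not-distribˡ-xor; not-distribʳ-xor)
open import Function using (_∘_; id)
open import Relation.Nullary using (¬_; Dec; yes; no; contradiction)
open import Relation.Nullary.Decidable using (isYes; _⊎-dec_)
open import Relation.Binary.PropositionalEquality using (_≡_; _≢_; refl; sym; trans; cong; module ≡-Reasoning)

maxF-upper : ∀ n (f : Fin n → ℕ) i → f i ≤ maxF n f
maxF-upper (suc n) f zero    = m≤m⊔n _ _
maxF-upper (suc n) f (suc i) = ≤-trans (maxF-upper n (f ∘ suc) i) (m≤n⊔m _ _)

maxF-least : ∀ n (f : Fin n → ℕ) {d} → (∀ i → f i ≤ d) → maxF n f ≤ d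
maxF-least zero    f bound = z≤n
maxF-least (suc n) f bound = ⊔-lub (bound zero) (maxF-least n (f ∘ suc) (bound ∘ suc))

least-or-none : {P : ℕ → Set} → (∀ n → Dec (P n)) → ∀ b →
                ∃[ m ] (P m × ∀ e → P e → m ≤ e) ⊎ (∀ e → e < b → ¬ P e)
least-or-none P? zero = inj₂ (λ _ ())
least-or-none {P} P? (suc b) with least-or-none P? b | P? b
... | inj₁ least | _      = inj₁ least
... | inj₂ none  | yes pb = inj₁ (b , pb , λ e pe → ≮⇒≥ (λ e<b → none e e<b pe))
... | inj₂ none  | no ¬pb = inj₂ below
  where
  below : ∀ e → e < suc b → ¬ P e
  below e e<1+b with m<1+n⇒m<n∨m≡n e<1+b
  ... | inj₁ e<b  = none e e<b
  ... | inj₂ refl = ¬pb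

least-witness : {P : ℕ → Set} → (∀ n → Dec (P n)) → ∀ {n} → P n →
                ∃[ m ] (P m × ∀ e → P e → m ≤ e)
least-witness P? {n} pn with least-or-none P? (suc n)
... | inj₁ least = least
... | inj₂ none  = contradiction pn (none n ≤-refl)

≢⇒∃-lookup≢ : ∀ {n m} {v w : Vec (Fin m) n} → v ≢ w → ∃[ j ] lookup v j ≢ lookup w j
≢⇒∃-lookup≢ {n} {v = v} {w} v≢w =
  ¬∀⟶∃¬ n _ (λ j → lookup v j ≟ lookup w j) (λ agree → v≢w (extensional agree))
  where
  open ≡-Reasoning
  extensional : (∀ j → lookup v j ≡ lookup w j) → v ≡ w
  extensional agree = begin
    v                  ≡⟨ sym (tabulate∘lookup v) ⟩
    tabulate (lookup v) ≡⟨ tabulate-cong agree ⟩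
    tabulate (lookup w) ≡⟨ tabulate∘lookup w ⟩
    w                  ∎

length-concat-tabulate≤ : ∀ {A : Set} n (f : Fin n → List A) {B} → (∀ i → length (f i) ≤ B) →
                          length (concat (List.tabulate f)) ≤ n * B
length-concat-tabulate≤ zero    f bound = z≤n
length-concat-tabulate≤ (suc n) f bound
  rewrite length-++ (f zero) {concat (List.tabulate (f ∘ suc))} =
  +-mono-≤ (bound zero) (length-concat-tabulate≤ n (f ∘ suc) (bound ∘ suc))

geometric : ℕ → ℕ → ℕ
geometric k zero    = 0
geometric k (suc d) = suc (k * geometric k d)

geometric<^ : ∀ {k} → 2 ≤ k → ∀ d → geometric k d < k ^ d
geometric<^ 2≤k zero = s≤s z≤n
geometric<^ {k} 2≤k (suc d) = begin-strict
  suc (k * geometric k d)  <⟨ +-monoˡ-≤ (k * geometric k d) 2≤k ⟩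
  k + k * geometric k d    ≡⟨ *-suc k (geometric k d) ⟨
  k * suc (geometric k d)  ≤⟨ *-monoʳ-≤ k (geometric<^ 2≤k d) ⟩
  k * k ^ d                ∎
  where open ≤-Reasoning

parity : ∀ n → (Fin n → Bool) → Bool
parity zero    f = false
parity (suc n) f = f zero xor parity n (f ∘ suc)

parity-cong : ∀ n {f g : Fin n → Bool} → (∀ i → f i ≡ g i) → parity n f ≡ parity n g
parity-cong zero    eq = refl
parity-cong (suc n) eq rewrite eq zero | parity-cong n (eq ∘ suc) = refl

parity-flip : ∀ n {f g : Fin n → Bool} j → (∀ i → i ≢ j → f i ≡ g i) → f j ≡ not (g j) →
              parity n f ≡ not (parity n g)
parity-flip (suc n) {f} {g} zero agree flip
  rewrite flip | parity-cong n (λ i → agree (suc i) (λ ())) = sym (not-distribˡ-xor (g zero) _)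
parity-flip (suc n) {f} {g} (suc j) agree flip
  rewrite agree zero (λ ())
        | parity-flip n j (λ i i≢j → agree (suc i) (i≢j ∘ suc-injective)) flip =
  sym (not-distribʳ-xor (g zero) _)

bit : Bool → Fin 2
bit false = zero
bit true  = suc zero

bit-not : ∀ b → bit b ≢ bit (not b)
bit-not false ()
bit-not true  ()

matchParity : ∀ {k n} → (Fin n → Fin k) → Vec (Fin k) n → Fin 2
matchParity {n = n} a v = bit (parity n (λ j → isYes (lookup v j ≟ a j)))

matchParity-separates : ∀ {k n} (a : Fin n → Fin k) {v w : Vec (Fin k) n} j →
  lookup v j ≡ a j → lookup v j ≢ lookup w j → (∀ i → i ≢ j → lookup v i ≡ lookup w i) →
  matchParity a v ≢ matchParity a w
matchParity-separates {n = n} a {v} {w} j vj≡aj vj≢wj agree eq =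
  bit-not (parity n matchesW)
    (trans (sym eq) (cong bit (parity-flip n j (λ i i≢j → cong (matches i) (agree i i≢j)) flipped)))
  where
  matches : ∀ i → Fin _ → Bool
  matches i x = isYes (x ≟ a i)
  matchesW : Fin n → Bool
  matchesW i = matches i (lookup w i)
  flipped : matches j (lookup v j) ≡ not (matchesW j)
  flipped with lookup v j ≟ a j | lookup w j ≟ a j
  ... | no vj≢aj | _        = contradiction vj≡aj vj≢aj
  ... | yes _    | yes wj≡aj = contradiction (trans vj≡aj (sym wj≡aj)) vj≢wj
  ... | yes _    | no _      = refl

attributes : ∀ {k} → Node k → List ℕ
attributes (leaf _)           = []
attributes (query a n lab ch) = a ∷ concat (List.tabulate (λ i → attributes (ch i)))

module DecisionTrees {k : ℕ} (T : Table k) where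

  Row : Set
  Row = Vec (Fin k) (W T) × Fin 2

  attr : Fin (W T) → ℕ
  attr = lookup (attrs T)

  Covers : List Row → Node k → Set
  Covers R t = ∀ r → r ∈ R → ∃[ cs ] ∃[ d ] (Path t cs d × Sat T cs (proj₁ r))

  Consistent : List Row → Node k → Set
  Consistent R t = ∀ cs d → Path t cs d → ∀ r → r ∈ R → Sat T cs (proj₁ r) → proj₂ r ≡ d

  Solves : List Row → Node k → Set
  Solves R t = WellFormed T t × Covers R t × Consistent R t

  Constant : List Row → Set
  Constant R = ∃[ e ] All (λ r → proj₂ r ≡ e) R

  hasValue? : ∀ j δ (r : Row) → Dec (lookup (proj₁ r) j ≡ δ)
  hasValue? j δ r = lookup (proj₁ r) j ≟ δ

  restrict : Fin (W T) → Fin k → List Row → List Row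
  restrict j δ = filter (hasValue? j δ)

  -- A decidable, tree-free description of "some tree of depth ≤ d solves R".
  Resolvable : ℕ → List Row → Set
  Resolvable zero    R = Constant R
  Resolvable (suc d) R = Constant R ⊎ ∃[ j ] (∀ δ → Resolvable d (restrict j δ R))

  constant? : ∀ R → Dec (Constant R)
  constant? R = any? (λ e → All.all? (λ r → proj₂ r ≟ e) R)

  resolvable? : ∀ d R → Dec (Resolvable d R)
  resolvable? zero    R = constant? R
  resolvable? (suc d) R = constant? R ⊎-dec any? (λ j → all? (λ δ → resolvable? d (restrict j δ R)))

  constant⇒resolvable : ∀ d R → Constant R → Resolvable d R
  constant⇒resolvable zero    R c = c
  constant⇒resolvable (suc d) R c = inj₁ c

  sat-head : ∀ j {δ cs} v → Sat T ((attr j , δ) ∷ cs) v → lookup v j ≡ δ × Sat T cs v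
  sat-head j _ ((j′ , attr≡ , v≡δ) ∷ s) with attrs-distinct T j′ j attr≡
  ... | refl = v≡δ , s

  leaf-solves : ∀ {R} (c : Constant R) → Solves R (leaf (proj₁ c))
  leaf-solves (e , decisions≡e) =
    tt , (λ r _ → [] , e , leafP , []) , λ { [] _ leafP r r∈R [] → All.lookup decisions≡e r∈R }

  query-solves : ⦃ _ : NonZero k ⦄ → ∀ {R} j (ch : Fin k → Node k) →
                 (∀ δ → Solves (restrict j δ R) (ch δ)) → Solves R (query (attr j) k id ch)
  query-solves ⦃ nz ⦄ {R} j ch solves =
    (nz , (λ _ _ → id) , (j , refl) , proj₁ ∘ solves) , covers , consistent
    where
    covers : Covers R (query (attr j) k id ch)
    covers r r∈R with proj₁ (proj₂ (solves (lookup (proj₁ r) j))) r (∈-filter⁺ (hasValue? j _) r∈R refl)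
    ... | cs , d , path , sat = _ , d , stepP _ path , (j , refl , refl) ∷ sat
    consistent : Consistent R (query (attr j) k id ch)
    consistent _ d (stepP δ path) r r∈R sat with sat-head j (proj₁ r) sat
    ... | vj≡δ , sat′ = proj₂ (proj₂ (solves δ)) _ d path r (∈-filter⁺ (hasValue? j δ) r∈R vj≡δ) sat′

  resolvable⇒solved : ⦃ _ : NonZero k ⦄ → ∀ d R → Resolvable d R →
                      ∃[ t ] (Solves R t × depth t ≤ d)
  resolvable⇒solved zero    R c        = leaf _ , leaf-solves c , z≤n
  resolvable⇒solved (suc d) R (inj₁ c) = leaf _ , leaf-solves c , z≤n
  resolvable⇒solved (suc d) R (inj₂ (j , split)) =
    query (attr j) k id (proj₁ ∘ sub) ,
    query-solves j _ (proj₁ ∘ proj₂ ∘ sub) ,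
    s≤s (maxF-least k _ (proj₂ ∘ proj₂ ∘ sub))
    where
    sub : ∀ δ → ∃[ t ] (Solves (restrict j δ R) t × depth t ≤ d)
    sub δ = resolvable⇒solved d (restrict j δ R) (split δ)

  covering-step : ∀ {R j n lab ch r} → Covers R (query (attr j) n lab ch) → r ∈ R →
    ∃[ i ] (lab i ≡ lookup (proj₁ r) j × ∃[ cs ] ∃[ d ] (Path (ch i) cs d × Sat T cs (proj₁ r)))
  covering-step {j = j} {r = r} covers r∈R with covers _ r∈R
  ... | _ , d , stepP i path , sat with sat-head j (proj₁ r) sat
  ...   | vj≡lab , sat′ = i , sym vj≡lab , _ , d , path , sat′

  child-solves : ∀ {R j n lab ch i δ} → Solves R (query (attr j) n lab ch) → lab i ≡ δ →
                 Solves (restrict j δ R) (ch i)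
  child-solves {j = j} {i = i} {δ = δ} (( _ , lab-inj , _ , wf) , covers , consistent) lab≡δ =
    wf i , covers′ , consistent′
    where
    covers′ : Covers _ _
    covers′ r r∈ with ∈-filter⁻ (hasValue? j δ) r∈
    ... | r∈R , vj≡δ with covering-step covers r∈R
    ...   | i′ , lab≡vj , rest with lab-inj i′ i (trans lab≡vj (trans vj≡δ (sym lab≡δ)))
    ...     | refl = rest
    consistent′ : Consistent _ _
    consistent′ cs d path r r∈ sat with ∈-filter⁻ (hasValue? j δ) r∈
    ... | r∈R , vj≡δ = consistent _ d (stepP i path) r r∈R ((j , refl , trans vj≡δ (sym lab≡δ)) ∷ sat)

  solved⇒resolvable : ∀ t d R → Solves R t → depth t ≤ d → Resolvable d R
  solved⇒resolvable (leaf e) d R (_ , _ , consistent) _ =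
    constant⇒resolvable d R (e , All.tabulate (λ r∈R → consistent [] e leafP _ r∈R []))
  solved⇒resolvable (query _ n lab ch) (suc d) R solves@((_ , _ , (j , refl) , _) , covers , _) (s≤s depth≤d) =
    inj₂ (j , resolve)
    where
    resolve : ∀ δ → Resolvable d (restrict j δ R)
    resolve δ with any? (λ i → lab i ≟ δ)
    ... | yes (i , lab≡δ) =
      solved⇒resolvable (ch i) d _ (child-solves solves lab≡δ) (≤-trans (maxF-upper n _ i) depth≤d)
    ... | no no-edge = constant⇒resolvable d _ (zero , All.tabulate unreachable)
      where
      unreachable : ∀ {r} → r ∈ restrict j δ R → proj₂ r ≡ zero
      unreachable r∈ with ∈-filter⁻ (hasValue? j δ) r∈
      ... | r∈R , vj≡δ with covering-step covers r∈R
      ...   | i , lab≡vj , _ = contradiction (i , trans lab≡vj vj≡δ) no-edge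

  restrict-unique : ∀ {R} j δ → Unique (map proj₁ R) → Unique (map proj₁ (restrict j δ R))
  restrict-unique j δ = AllPairs.map⁺ ∘ AllPairs.filter⁺ _ ∘ AllPairs.map⁻

  -- Splitting on a column where the first two rows differ removes one of them from each part.
  resolvable-by-length : ∀ n R → length R ≤ n → Unique (map proj₁ R) → Resolvable n R
  resolvable-by-length n []          _ _ = constant⇒resolvable n [] (zero , [])
  resolvable-by-length n (r ∷ [])    _ _ = constant⇒resolvable n _ (proj₂ r , refl ∷ [])
  resolvable-by-length (suc n) R@(r ∷ s ∷ _) (s≤s length≤n) unique@((r≢s ∷ _) ∷ _) =
    inj₂ (j , λ δ → resolvable-by-length n (restrict j δ R) (shorter δ) (restrict-unique j δ unique))
    where
    differing : ∃[ j ] lookup (proj₁ r) j ≢ lookup (proj₁ s) j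
    differing = ≢⇒∃-lookup≢ r≢s
    j : Fin (W T)
    j = proj₁ differing
    misses : ∀ δ → Any.Any (λ x → lookup (proj₁ x) j ≢ δ) R
    misses δ with lookup (proj₁ r) j ≟ δ
    ... | yes rj≡δ = there (here (λ sj≡δ → proj₂ differing (trans rj≡δ (sym sj≡δ))))
    ... | no rj≢δ  = here rj≢δ
    shorter : ∀ δ → length (restrict j δ R) ≤ n
    shorter δ = ≤-trans (<⇒≤pred (filter-notAll (hasValue? j δ) R (misses δ))) length≤n

  hd-exists : ⦃ _ : NonZero k ⦄ → ∃[ h ] IsHd T h
  hd-exists
    with least-witness (λ d → resolvable? d (rows T))
                       (resolvable-by-length _ (rows T) ≤-refl (rows-distinct T))
  ... | h , resolvable , minimal with resolvable⇒solved h (rows T) resolvable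
  ...   | t , solves , depth≤h =
    h , (t , solves , ≤-antisym depth≤h (lower-bound t solves)) , lower-bound
    where
    lower-bound : ∀ t → Solves (rows T) t → h ≤ depth t
    lower-bound t solves = minimal _ (solved⇒resolvable t _ _ solves ≤-refl)

  separated-column-queried : ∀ t j {cs₁ cs₂ d₁ d₂} v₁ v₂ → WellFormed T t →
    Path t cs₁ d₁ → Path t cs₂ d₂ → Sat T cs₁ v₁ → Sat T cs₂ v₂ →
    (∀ i → i ≢ j → lookup v₁ i ≡ lookup v₂ i) → d₁ ≢ d₂ → attr j ∈ attributes t
  separated-column-queried (leaf _) j _ _ _ leafP leafP _ _ _ d₁≢d₂ = contradiction refl d₁≢d₂
  separated-column-queried (query _ n lab ch) j v₁ v₂ (_ , lab-inj , (j₀ , refl) , wf)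
                           (stepP i₁ path₁) (stepP i₂ path₂) sat₁ sat₂ agree d₁≢d₂
    with sat-head j₀ v₁ sat₁ | sat-head j₀ v₂ sat₂ | j₀ ≟ j
  ... | _ | _ | yes refl = here refl
  ... | v₁≡lab , sat₁′ | v₂≡lab , sat₂′ | no j₀≢j
    with lab-inj i₁ i₂ (trans (sym v₁≡lab) (trans (agree j₀ j₀≢j) v₂≡lab))
  ... | refl = there (∈-concat⁺′
        (separated-column-queried (ch i₁) j v₁ v₂ (wf i₁) path₁ path₂ sat₁′ sat₂′ agree d₁≢d₂)
        (∈-tabulate⁺ i₁))

  length-attributes≤ : ∀ t d → WellFormed T t → depth t ≤ d → length (attributes t) ≤ geometric k d
  length-attributes≤ (leaf _) d _ _ = z≤n
  length-attributes≤ (query a n lab ch) (suc d) (_ , lab-inj , _ , wf) (s≤s depth≤d) =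
    s≤s (≤-trans (length-concat-tabulate≤ n _ children)
                 (*-monoˡ-≤ (geometric k d) (injective⇒≤ (λ {i} {i′} → lab-inj i i′))))
    where
    children : ∀ i → length (attributes (ch i)) ≤ geometric k d
    children i = length-attributes≤ (ch i) d (wf i) (≤-trans (maxF-upper n _ i) depth≤d)

  distinguished-column-queried : ∀ {R t} → Solves R t → ∀ j {r₁ r₂} → r₁ ∈ R → r₂ ∈ R →
    (∀ i → i ≢ j → lookup (proj₁ r₁) i ≡ lookup (proj₁ r₂) i) → proj₂ r₁ ≢ proj₂ r₂ →
    attr j ∈ attributes t
  distinguished-column-queried {t = t} (wf , covers , consistent) j {r₁} {r₂} r₁∈ r₂∈ agree r₁≢r₂
    with covers _ r₁∈ | covers _ r₂∈
  ... | cs₁ , d₁ , path₁ , sat₁ | cs₂ , d₂ , path₂ , sat₂ =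
    separated-column-queried t j (proj₁ r₁) (proj₁ r₂) wf path₁ path₂ sat₁ sat₂ agree λ d₁≡d₂ →
      r₁≢r₂ (trans (consistent cs₁ d₁ path₁ _ r₁∈ sat₁)
                   (trans d₁≡d₂ (sym (consistent cs₂ d₂ path₂ _ r₂∈ sat₂))))

  W≤length : ∀ L → (∀ j → attr j ∈ L) → W T ≤ length L
  W≤length L mem = injective⇒≤ (λ {i} {j} → position-injective)
    where
    position-injective : ∀ {i j} → Any.index (mem i) ≡ Any.index (mem j) → i ≡ j
    position-injective {i} {j} eq = attrs-distinct T i j
      (trans (lookup-index (mem i)) (trans (cong (List.lookup L) eq) (sym (lookup-index (mem j)))))

lemma13 : ∀ {k : ℕ} → 2 ≤ k → (T : Table k) → Critical T →
    ∃[ ν ] ∃[ h ] (IsHd (J T ν) h × W T < 2 * k ^ h)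
lemma13 {k} 2≤k T (_ , critical) = ν , h , hd , W<2*k^h
  where
  nonZero : NonZero k
  nonZero = ℕ.>-nonZero (≤-trans (s≤s z≤n) 2≤k)
  a : Fin (W T) → Fin k
  a j = lookup (proj₁ (proj₁ (critical j))) j
  ν : Vec (Fin k) (W T) → Fin 2
  ν = matchParity a
  relabel : Vec (Fin k) (W T) × Fin 2 → Vec (Fin k) (W T) × Fin 2
  relabel r = proj₁ r , ν (proj₁ r)
  open DecisionTrees (J T ν)
  hd-witness : ∃[ h ] IsHd (J T ν) h
  hd-witness = hd-exists ⦃ nonZero ⦄
  h : ℕ
  h = proj₁ hd-witness
  hd : IsHd (J T ν) h
  hd = proj₂ hd-witness
  t : Node k
  t = proj₁ (proj₁ hd)
  solves : Solves (rows (J T ν)) t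
  solves = proj₁ (proj₂ (proj₁ hd))
  depth≡h : depth t ≡ h
  depth≡h = proj₂ (proj₂ (proj₁ hd))
  every-column-queried : ∀ j → attr j ∈ attributes t
  every-column-queried j =
    let (r₁ , r₂ , r₁∈ , r₂∈ , differ , agree) = critical j
    in distinguished-column-queried solves j (∈-map⁺ relabel r₁∈) (∈-map⁺ relabel r₂∈) agree
         (matchParity-separates a {proj₁ r₁} {proj₁ r₂} j refl differ agree)
  open ≤-Reasoning
  W<2*k^h : W T < 2 * k ^ h
  W<2*k^h = begin-strict
    W T                                  ≤⟨ W≤length _ every-column-queried ⟩
    length (attributes t)                ≤⟨ length-attributes≤ t _ (proj₁ solves) ≤-refl ⟩
    geometric k (depth t)                <⟨ geometric<^ 2≤k (depth t) ⟩
    k ^ depth t                          ≡⟨ cong (k ^_) depth≡h ⟩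
    k ^ h                                ≤⟨ m≤n*m (k ^ h) 2 ⟩
    2 * k ^ h                            ∎
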